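{- Let $r$ be a positive integer and let $F:\mathbf{Set}^r\to\mathbf{Set}$ be a decomposable $r$-sort species with composition operator $\eta$. Let $\Omega\ne\boldsymbol\emptyset$ be an object of $\mathbf{Set}^r$ and fix a base point $(\omega,\rho)\in\Omega$. Then the sets $\eta(F_\eta[\Omega_1]\times F[\Omega-\Omega_1])$, for $\Omega_1$ ranging over all objects with $(\omega,\rho)\in\Omega_1\subseteq\Omega$, are pairwise disjoint.
   Context: $\mathbf{Set}$ is the category of finite sets and bijections. Objects of $\mathbf{Set}^r$ are $r$-tuples $\Omega=(\Omega^{(1)},\dots,\Omega^{(r)})$ of finite sets; set operations on them are componentwise, and $\boldsymbol\emptyset=(\emptyset,\dots,\emptyset)$. $(\omega,\rho)\in\Omega$ means $\rho\in\{1,\dots,r\}$ and $\omega\in\Omega^{(\rho)}$. An $r$-sort species is a functor $F:\mathbf{Set}^r\to\mathbf{Set}$. A composition operator for $F$ is a family of injective maps $\eta_{(\Omega_1,\Omega_2)}:F[\Omega_1]\times F[\Omega_2]\to F[\Omega_1\amalg\Omega_2]$, one for each disjoint pair, with the following two properties. - Naturality: $\eta_{(\tilde\Omega_1,\tilde\Omega_2)}\circ(F[f_1]\times F[f_2])=F[f_1\amalg f_2]\circ\eta_{(\Omega_1,\Omega_2)}$ for tuples of bijections $f_i:\Omega_i\to\tilde\Omega_i$. - Axiom (D1): whenever $\Omega_1\amalg\Omega_2=\Omega=\tilde\Omega_1\amalg\tilde\Omega_2$, \[ \eta(F[\Omega_1]\times F[\Omega_2])\cap\eta(F[\tilde\Omega_1]\times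 F[\tilde\Omega_2])=\eta(\eta(F[\Omega_{11}]\times F[\Omega_{12}])\times\eta(F[\Omega_{21}]\times F[\Omega_{22}])), \] where $\Omega_{ij}=\Omega_i\cap\tilde\Omega_j$. $\eta(A\times B)$ denotes the image under the relevant $\eta$-map. $F$ is decomposable if some $F[\Omega]\ne\emptyset$ and $F$ admits a composition operator. Define $F_\eta[\boldsymbol\emptyset]=\emptyset$ and, for $\Omega\ne\boldsymbol\emptyset$, $F_\eta[\Omega]=F[\Omega]-\bigcup\eta(F[I]\times F[J])$, the union over disjoint pairs with $I\amalg J=\Omega$ and $I\ne\boldsymbol\emptyset\ne J$. -}

module Defs where

open import Data.Nat using (ℕ; _≤_)
open import Data.Fin using (Fin)
open import Data.Bool using (Bool; true; false; _∧_; _∨_; not; T)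
open import Data.Product using (Σ; _×_; _,_; proj₁; proj₂)
open import Data.Unit using (⊤)
open import Relation.Binary.PropositionalEquality using (_≡_; _≢_; refl; trans; cong)
open import Function.Bundles using (_⇔_)

-- We work in a fixed universe of labelled points: a point of sort ρ is a
-- pair (n , ρ) with n : ℕ and ρ : Fin r.  An object Ω of Set^r is a finite
-- subset of this universe, given by a Boolean membership function together
-- with a bound beyond which nothing is a member; Ω^(ρ) = {n | (n,ρ) ∈ Ω}.
-- Every r-tuple of finite sets is isomorphic to such an object.

El : ℕ → Set
El r = ℕ × Fin r

record Obj (r : ℕ) : Set where
  field
    mem    : El r → Bool
    bound  : ℕ
    finite : ∀ n ρ → bound ≤ n → mem (n , ρ) ≡ false
open Obj public

module _ {r : ℕ} where

  _∋_ : Obj r → El r → Set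
  Ω ∋ e = T (mem Ω e)

  ⟦_⟧ : Obj r → Set
  ⟦ Ω ⟧ = Σ (El r) (λ e → Ω ∋ e)

  NonEmpty : Obj r → Set
  NonEmpty Ω = Σ (El r) (λ e → Ω ∋ e)

  _⊆_ : Obj r → Obj r → Set
  A ⊆ B = ∀ e → A ∋ e → B ∋ e

  SameSet : Obj r → Obj r → Set
  SameSet A B = ∀ e → mem A e ≡ mem B e

  _∩_ : Obj r → Obj r → Obj r
  A ∩ B = record
    { mem = λ e → mem A e ∧ mem B e
    ; bound = bound A
    ; finite = fin }
    where
      fin : ∀ n ρ → bound A ≤ n → mem A (n , ρ) ∧ mem B (n , ρ) ≡ false
      fin n ρ le with mem A (n , ρ) | finite A n ρ le
      ... | false | refl = refl

  _─_ : Obj r → Obj r → Obj r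
  A ─ B = record
    { mem = λ e → mem A e ∧ not (mem B e)
    ; bound = bound A
    ; finite = fin }
    where
      fin : ∀ n ρ → bound A ≤ n → mem A (n , ρ) ∧ not (mem B (n , ρ)) ≡ false
      fin n ρ le with mem A (n , ρ) | finite A n ρ le
      ... | false | refl = refl

  record IsDisjUnion (A B C : Obj r) : Set where
    field
      union    : ∀ e → mem C e ≡ (mem A e ∨ mem B e)
      disjoint : ∀ e → (mem A e ∧ mem B e) ≡ false

  -- Morphisms of Set^r: tuples of bijections, i.e. sort-preserving
  -- bijections between the underlying point sets.

  record Bij (A B : Obj r) : Set where
    field
      to      : ⟦ A ⟧ → ⟦ B ⟧
      from    : ⟦ B ⟧ → ⟦ A ⟧
      to-from : ∀ b → proj₁ (to (from b)) ≡ proj₁ b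
      from-to : ∀ a → proj₁ (from (to a)) ≡ proj₁ a
      to-sort : ∀ a → proj₂ (proj₁ (to a)) ≡ proj₂ (proj₁ a)
  open Bij public

  idB : (A : Obj r) → Bij A A
  idB A = record
    { to = λ a → a ; from = λ a → a
    ; to-from = λ _ → refl ; from-to = λ _ → refl ; to-sort = λ _ → refl }

  private
    T-irr : (b : Bool) (p q : T b) → p ≡ q
    T-irr true _ _ = refl

    pt : {D : Obj r} (u v : ⟦ D ⟧) → proj₁ u ≡ proj₁ v → u ≡ v
    pt {D} (e , p) (.e , q) refl = cong (e ,_) (T-irr (mem D e) p q)

  _∘B_ : {A B C : Obj r} → Bij B C → Bij A B → Bij A C
  _∘B_ {A} {B} {C} g f = record
    { to = λ a → to g (to f a)
    ; from = λ c → from f (from g c)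
    ; to-from = λ c → trans (cong (λ u → proj₁ (to g u)) (pt {B} _ _ (to-from f (from g c)))) (to-from g c)
    ; from-to = λ a → trans (cong (λ u → proj₁ (from f u)) (pt {B} _ _ (from-to g (to f a)))) (from-to f a)
    ; to-sort = λ a → trans (to-sort g (to f a)) (to-sort f a) }

-- r-sort species: functors Set^r → Set.  Functoriality is stated
-- pointwise; map-cong says that F acts on morphisms (tuples of functions),
-- not on the chosen inverse data.

record Species (r : ℕ) : Set₁ where
  field
    F        : Obj r → Set
    map      : {A B : Obj r} → Bij A B → F A → F B
    map-id   : {A : Obj r} (x : F A) → map (idB A) x ≡ x
    map-∘    : {A B C : Obj r} (g : Bij B C) (f : Bij A B) (x : F A) →
               map (g ∘B f) x ≡ map g (map f x)
    map-cong : {A B : Obj r} (f g : Bij A B) →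
               (∀ a → proj₁ (to f a) ≡ proj₁ (to g a)) →
               (x : F A) → map f x ≡ map g x
open Species public

module _ {r : ℕ} (S : Species r) where

  -- type of a family of maps η_(Ω₁,Ω₂) : F[Ω₁] × F[Ω₂] → F[Ω₁ ∐ Ω₂]
  -- (the target Ω₁ ∐ Ω₂ is indicated by a proof that it is the disjoint union)
  EtaFamily : Set
  EtaFamily = {A B C : Obj r} → IsDisjUnion A B C → F S A → F S B → F S C

  Img : EtaFamily → (A B C : Obj r) → (F S A → Set) → (F S B → Set) → F S C → Set
  Img η A B C P Q z =
    Σ (IsDisjUnion A B C) λ d →
    Σ (F S A) λ x → P x × Σ (F S B) λ y → Q y × η d x y ≡ z

  All : {A : Obj r} → F S A → Set
  All _ = ⊤

  record CompositionOperator : Set where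
    field
      η         : EtaFamily
      injective : {A B C : Obj r} (d : IsDisjUnion A B C) (x x' : F S A) (y y' : F S B) →
                  η d x y ≡ η d x' y' → x ≡ x' × y ≡ y'
      natural   : {A B C A' B' C' : Obj r}
                  (d : IsDisjUnion A B C) (d' : IsDisjUnion A' B' C')
                  (f₁ : Bij A A') (f₂ : Bij B B') (g : Bij C C') →
                  -- g = f₁ ∐ f₂
                  (∀ (a : ⟦ A ⟧) (c : C ∋ proj₁ a) → proj₁ (to g (proj₁ a , c)) ≡ proj₁ (to f₁ a)) →
                  (∀ (b : ⟦ B ⟧) (c : C ∋ proj₁ b) → proj₁ (to g (proj₁ b , c)) ≡ proj₁ (to f₂ b)) →
                  (x : F S A) (y : F S B) →
                  η d' (map S f₁ x) (map S f₂ y) ≡ map S g (η d x y)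
      D1        : {Ω₁ Ω₂ Ω̃₁ Ω̃₂ Ω : Obj r} →
                  IsDisjUnion Ω₁ Ω₂ Ω → IsDisjUnion Ω̃₁ Ω̃₂ Ω → (z : F S Ω) →
                  (Img η Ω₁ Ω₂ Ω All All z × Img η Ω̃₁ Ω̃₂ Ω All All z)
                  ⇔ Img η Ω₁ Ω₂ Ω
                      (Img η (Ω₁ ∩ Ω̃₁) (Ω₁ ∩ Ω̃₂) Ω₁ All All)
                      (Img η (Ω₂ ∩ Ω̃₁) (Ω₂ ∩ Ω̃₂) Ω₂ All All) z

  Decomposable : Set
  Decomposable = Σ (Obj r) (F S) × CompositionOperator

  Fη : EtaFamily → (Ω : Obj r) → F S Ω → Set
  Fη η Ω z =
    NonEmpty Ω ×
    ({I J : Obj r} (d : IsDisjUnion I J Ω) → NonEmpty I → NonEmpty J →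
     (x : F S I) (y : F S J) → η d x y ≢ z)

module Submission where

-- Suppose z = η(x , y) with x ∈ F_η[A], y ∈ F[Ω - A], and also z = η(x' , y')
-- for some other decomposition Ω = A' ∐ (Ω - A').  Axiom (D1) refines both
-- decompositions into a common one, z = η(η(a , b) , ·) with
-- a ∈ F[A ∩ A'] and b ∈ F[A ∩ (Ω - A')]; injectivity of η gives
-- x = η(a , b).  Since x is indecomposable and A ∩ A' contains the base
-- point, A ∩ (Ω - A') must be empty, i.e. A ⊆ A'.  Applying this in both
-- directions gives Ω₁ = Ω₁', which is the claimed disjointness.

open import Defs
open import Data.Nat using (ℕ; _≤_)
open import Data.Bool using (true; false)
open import Data.Bool.Properties using (T-∧)
open import Data.Product using (Σ; _×_; _,_; proj₁; proj₂)
open import Data.Unit using (tt)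
open import Data.Empty using (⊥-elim)
open import Relation.Nullary using (¬_; yes; no)
open import Relation.Nullary.Decidable using (T?)
open import Relation.Binary.PropositionalEquality using (_≡_; refl; sym; trans; cong₂)
open import Function.Bundles using (Equivalence)

module _ {r : ℕ} where

  ∈-∩ : {A B : Obj r} {e : El r} → A ∋ e → B ∋ e → (A ∩ B) ∋ e
  ∈-∩ a b = Equivalence.from T-∧ (a , b)

  ∈-─ : {A B : Obj r} {e : El r} → A ∋ e → ¬ (B ∋ e) → (A ─ B) ∋ e
  ∈-─ {B = B} {e} a b∉ with mem B e
  ... | true  = ⊥-elim (b∉ tt)
  ... | false = Equivalence.from T-∧ (a , tt)

  ⊆-antisym : {A B : Obj r} → A ⊆ B → B ⊆ A → SameSet A B
  ⊆-antisym {A} {B} A⊆B B⊆A e with mem A e | mem B e | A⊆B e | B⊆A e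
  ... | false | false | _   | _   = refl
  ... | true  | true  | _   | _   = refl
  ... | true  | false | A→B | _   = ⊥-elim (A→B tt)
  ... | false | true  | _   | B→A = ⊥-elim (B→A tt)

  ⊆-from-empty-overlap : {Ω A A' : Obj r} → A ⊆ Ω →
                         ¬ NonEmpty (A ∩ (Ω ─ A')) → A ⊆ A'
  ⊆-from-empty-overlap {Ω} {A} {A'} A⊆Ω empty e a with T? (mem A' e)
  ... | yes a' = a'
  ... | no  a'∉ = ⊥-elim (empty (e , ∈-∩ {A} {Ω ─ A'} a (∈-─ {Ω} {A'} (A⊆Ω e a) a'∉)))

module _ {r : ℕ} (S : Species r) (C : CompositionOperator S) where
  open CompositionOperator C

  forget-factors : {A B Ω : Obj r} {P : F S A → Set} {Q : F S B → Set} {z : F S Ω} →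
                   Img S η A B Ω P Q z → Img S η A B Ω (All S) (All S) z
  forget-factors (d , x , _ , y , _ , eq) = d , x , tt , y , tt , eq

  -- η does not depend on the proof that its target is the disjoint union:
  -- naturality applied to identity bijections.
  η-irrelevant : {A B D : Obj r} (d d' : IsDisjUnion A B D) (x : F S A) (y : F S B) →
                 η d x y ≡ η d' x y
  η-irrelevant {A} {B} {D} d d' x y =
    trans (sym (map-id S (η d x y)))
      (trans (sym (natural d d' (idB A) (idB B) (idB D) (λ _ _ → refl) (λ _ _ → refl) x y))
        (cong₂ (η d') (map-id S x) (map-id S y)))

  -- Core consequence of (D1): if z = η(x , y) with x ∈ F_η[A], and z also
  -- lies in η(F[A'] × F[B']) with A ∩ A' nonempty, then A ∩ B' is empty,
  -- because D1 would otherwise exhibit x as a proper η-product.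
  indecomposable-overlap : {A B A' B' Ω : Obj r} {z : F S Ω} →
    Img S η A B Ω (Fη S η A) (All S) z → Img S η A' B' Ω (All S) (All S) z →
    NonEmpty (A ∩ A') → ¬ NonEmpty (A ∩ B')
  indecomposable-overlap {z = z} z∈@(d , x , x-indec , y , _ , eq) z∈' meets meets'
    with Equivalence.to (D1 d (proj₁ z∈') z) (forget-factors z∈ , z∈')
  ... | d'' , x'' , (dA , a , _ , b , _ , x''≡ηab) , y'' , _ , z≡η''
    = proj₂ x-indec dA meets meets' a b (trans x''≡ηab x''≡x)
    where
      x''≡x : x'' ≡ x
      x''≡x = proj₁ (injective d x'' x y'' y
                (trans (η-irrelevant d d'' x'' y'') (trans z≡η'' (sym eq))))

  indecomposable-part-⊆ : {Ω A A' : Obj r} {base : El r} {z : F S Ω} →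
    A ∋ base → A' ∋ base → A ⊆ Ω →
    Img S η A (Ω ─ A) Ω (Fη S η A) (All S) z →
    Img S η A' (Ω ─ A') Ω (All S) (All S) z → A ⊆ A'
  indecomposable-part-⊆ {Ω} {A} {A'} {base} b b' A⊆Ω z∈ z∈' =
    ⊆-from-empty-overlap {Ω = Ω} {A = A} {A' = A'} A⊆Ω
      (indecomposable-overlap z∈ z∈' (base , ∈-∩ {A = A} {B = A'} b b'))

lemma3p9 : (r : ℕ) → 1 ≤ r → (S : Species r) →
    Σ (Obj r) (F S) → (C : CompositionOperator S) →
    (Ω : Obj r) → NonEmpty Ω → (base : El r) → Ω ∋ base →
    (Ω₁ Ω₁' : Obj r) → Ω₁ ∋ base → Ω₁ ⊆ Ω → Ω₁' ∋ base → Ω₁' ⊆ Ω →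
    ¬ SameSet Ω₁ Ω₁' → (z : F S Ω) →
    ¬ (Img S (CompositionOperator.η C) Ω₁ (Ω ─ Ω₁) Ω (Fη S (CompositionOperator.η C) Ω₁) (All S) z
    × Img S (CompositionOperator.η C) Ω₁' (Ω ─ Ω₁') Ω (Fη S (CompositionOperator.η C) Ω₁') (All S) z)
lemma3p9 r _ S _ C Ω _ base _ Ω₁ Ω₁' b₁ Ω₁⊆Ω b₁' Ω₁'⊆Ω Ω₁≢Ω₁' z (z∈₁ , z∈₁') =
  Ω₁≢Ω₁' (⊆-antisym {A = Ω₁} {B = Ω₁'}
    (indecomposable-part-⊆ S C b₁ b₁' Ω₁⊆Ω z∈₁ (forget-factors S C z∈₁'))
    (indecomposable-part-⊆ S C b₁' b₁ Ω₁'⊆Ω z∈₁' (forget-factors S C z∈₁)))
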